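{- Let $1 \leq m \leq n$ and let $K_{m,n}$ be the complete bipartite graph with parts of sizes $m$ and $n$. Then $\chi_s(S(K_{m,n})) = 2m+1$.
   Context: All graphs are finite, simple and undirected. A star coloring of a graph $G$ is a proper vertex coloring of $G$ in which every path on four vertices uses at least three distinct colors. The star chromatic number $\chi_s(G)$ is the least number of colors in a star coloring of $G$. The splitting graph $S(G)$ of a graph $G$ is obtained from $G$ by adding, for each vertex $v$ of $G$, a new vertex $v'$ whose neighborhood is $N(v')=N(v)$, the neighborhood of $v$ in $G$ (the new vertices are pairwise nonadjacent). -}

module Defs where

open import Level using (0ℓ)
open import Data.Nat using (ℕ; _<_)
open import Data.Fin using (Fin)
open import Data.Sum using (_⊎_; inj₁; inj₂)
open import Data.Product using (_×_; ∃-syntax)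
open import Data.Unit using (⊤)
open import Data.Empty using (⊥)
open import Relation.Binary.PropositionalEquality using (_≡_; _≢_)

-- A graph: a vertex type with an adjacency relation.
-- (All graphs built below are finite, simple: symmetric and irreflexive.)
record Graph : Set₁ where
  field
    V   : Set
    Adj : V → V → Set
open Graph public

KAdj : (m n : ℕ) → Fin m ⊎ Fin n → Fin m ⊎ Fin n → Set
KAdj m n (inj₁ _) (inj₁ _) = ⊥
KAdj m n (inj₁ _) (inj₂ _) = ⊤
KAdj m n (inj₂ _) (inj₁ _) = ⊤
KAdj m n (inj₂ _) (inj₂ _) = ⊥

K : ℕ → ℕ → Graph
K m n = record { V = Fin m ⊎ Fin n ; Adj = KAdj m n }

-- Splitting graph S(G): vertices inj₁ v (original) and inj₂ v (the copy v'),
-- with N(v') = N(v) and the copies pairwise nonadjacent.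
SAdj : (G : Graph) → V G ⊎ V G → V G ⊎ V G → Set
SAdj G (inj₁ u) (inj₁ v) = Adj G u v
SAdj G (inj₁ u) (inj₂ v) = Adj G u v
SAdj G (inj₂ u) (inj₁ v) = Adj G u v
SAdj G (inj₂ u) (inj₂ v) = ⊥

S : Graph → Graph
S G = record { V = V G ⊎ V G ; Adj = SAdj G }

Distinct3 : {A : Set} → A → A → A → Set
Distinct3 x y z = x ≢ y × x ≢ z × y ≢ z

AtLeast3 : {A : Set} → A → A → A → A → Set
AtLeast3 a b c d =
  Distinct3 a b c ⊎ Distinct3 a b d ⊎ Distinct3 a c d ⊎ Distinct3 b c d

IsP4 : (G : Graph) → V G → V G → V G → V G → Set
IsP4 G a b c d =
  (a ≢ b × a ≢ c × a ≢ d × b ≢ c × b ≢ d × c ≢ d) ×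
  Adj G a b × Adj G b c × Adj G c d

record StarColoring (G : Graph) (k : ℕ) : Set where
  field
    col    : V G → Fin k
    proper : ∀ u v → Adj G u v → col u ≢ col v
    star   : ∀ a b c d → IsP4 G a b c d →
             AtLeast3 (col a) (col b) (col c) (col d)

StarChromaticNumber : Graph → ℕ → Set
StarChromaticNumber G k =
  StarColoring G k × (∀ j → j < k → StarColoring G j → ⊥)

-- Write A, A' for the originals and copies of the m-part, B, B' for those
-- of the n-part.  Every edge of S(K_{m,n}) joins A ∪ A' to B ∪ B', copies
-- are never adjacent to each other.
--
-- Upper bound: in a bipartite graph, colouring one side injectively and the
-- other side with colours unused on the first side is a star colouring
-- (a path on four vertices has two vertices on the injective side).  We
-- give the 2m vertices of A ∪ A' their own colours and all of B ∪ B' one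
-- further colour.
--
-- Lower bound: in a star colouring no path a-b-c-d is 2-coloured, so two
-- equally coloured vertices force their common neighbours to be rainbow.
-- Counting a rainbow family against the k colours (pigeonhole), we get
-- 2m + 1 ≤ k by cases: either A ∪ A' is rainbow (add an original of B); or
-- it has a collision, making B rainbow, and then either A has a collision,
-- making B ∪ B' rainbow (add an original of A), or A ∪ B is rainbow and
-- one copy a'₀ or b'₀ brings a new colour, since if both repeated colours
-- a'₀ ~ aᵢ and b'₀ ~ bⱼ, the path a'₀ - bⱼ - aᵢ - b'₀ would be 2-coloured.
module Submission where

open import Defs
open import Data.Nat using (ℕ; _≤_; _<_; _+_; _*_)
open import Data.Nat.Properties using (≤-refl; ≤-trans; +-mono-≤; +-monoˡ-≤; +-identityʳ; <⇒≱)
open import Data.Fin using (Fin; zero; suc; splitAt; join; _↑ˡ_; _↑ʳ_; combine; fromℕ<; _≟_)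
open import Data.Fin.Properties using (join-splitAt; splitAt-↑ˡ; splitAt-↑ʳ; ↑ˡ-injective; combine-injective; injective⇒≤; any?)
open import Data.Sum using (_⊎_; inj₁; inj₂; [_,_]; [_,_]′; reduce)
open import Data.Product using (_×_; _,_; ∃-syntax)
open import Data.Unit using (tt)
open import Data.Empty using (⊥; ⊥-elim)
open import Data.Bool using (Bool; true; false; not)
open import Data.Bool.Properties using (¬-not)
open import Function using (_∘_; id)
open import Function.Definitions using (Injective)
open import Relation.Nullary using (yes; no; ¬?)
open import Relation.Nullary.Decidable using (_×-dec_; decidable-stable)
open import Relation.Binary.PropositionalEquality using (_≡_; _≢_; refl; sym; trans; cong; subst; ≢-sym)

private
  variable
    A : Set
    k m n p q : ℕ

InjectiveFn : {X Y : Set} → (X → Y) → Set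
InjectiveFn = Injective _≡_ _≡_

↑ˡ≢↑ʳ : (i : Fin p) (j : Fin q) → i ↑ˡ q ≢ p ↑ʳ j
↑ˡ≢↑ʳ {p} {q} i j e
  with () ← trans (sym (splitAt-↑ˡ p i q)) (trans (cong (splitAt p) e) (splitAt-↑ʳ p q j))

infixr 5 _⊕_
_⊕_ : (Fin p → A) → (Fin q → A) → Fin (p + q) → A
_⊕_ {p = p} f g = [ f , g ]′ ∘ splitAt p

splitAt-injective : ∀ p {q} → InjectiveFn (splitAt p {q})
splitAt-injective p {q} {x} {y} e =
  trans (sym (join-splitAt p q x)) (trans (cong (join p q) e) (join-splitAt p q y))

⊕-all : {P : A → Set} {f : Fin p → A} {g : Fin q → A} →
        (∀ i → P (f i)) → (∀ j → P (g j)) → ∀ x → P ((f ⊕ g) x)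
⊕-all {p = p} {P = P} {f} {g} Pf Pg x =
  [_,_] {C = λ s → P ([ f , g ]′ s)} Pf Pg (splitAt p x)

⊕-injective : {B : Set} {h : A → B} {f : Fin p → A} {g : Fin q → A} →
              InjectiveFn (h ∘ f) → InjectiveFn (h ∘ g) →
              (∀ i j → h (f i) ≢ h (g j)) → InjectiveFn (h ∘ (f ⊕ g))
⊕-injective {p = p} {h = h} {f} {g} hf hg apart {x} {y} e =
  splitAt-injective p (on-halves (splitAt p x) (splitAt p y) e)
  where
  on-halves : ∀ s t → h ([ f , g ]′ s) ≡ h ([ f , g ]′ t) → s ≡ t
  on-halves (inj₁ i) (inj₁ j) e = cong inj₁ (hf e)
  on-halves (inj₁ i) (inj₂ j) e = ⊥-elim (apart i j e)
  on-halves (inj₂ i) (inj₁ j) e = ⊥-elim (apart j i (sym e))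
  on-halves (inj₂ i) (inj₂ j) e = cong inj₂ (hg e)

module Colours (col : A → Fin k) where

  Rainbow : (Fin p → A) → Set
  Rainbow f = InjectiveFn (col ∘ f)

  Collision : (Fin p → A) → Set
  Collision f = ∃[ i ] ∃[ j ] i ≢ j × col (f i) ≡ col (f j)

  rainbow-or-collision : (f : Fin p → A) → Rainbow f ⊎ Collision f
  rainbow-or-collision f
    with any? (λ i → any? (λ j → ¬? (i ≟ j) ×-dec (col (f i) ≟ col (f j))))
  ... | yes (i , j , i≢j , same) = inj₂ (i , j , i≢j , same)
  ... | no none = inj₁ λ {i} {j} same →
          decidable-stable (i ≟ j) (λ i≢j → none (i , j , i≢j , same))

  rainbow-size : {f : Fin p → A} → Rainbow f → p ≤ k
  rainbow-size = injective⇒≤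

  rainbow-⊕ : {f : Fin p → A} {g : Fin q → A} → Rainbow f → Rainbow g →
              (∀ i j → col (f i) ≢ col (g j)) → Rainbow (f ⊕ g)
  rainbow-⊕ {f = f} {g} = ⊕-injective {h = col} {f = f} {g = g}

  rainbow-with-new-colour : {f : Fin p → A} {x : A} →
                            Rainbow f → (∀ i → col (f i) ≢ col x) → p + 1 ≤ k
  rainbow-with-new-colour {x = x} rf new =
    rainbow-size (rainbow-⊕ {g = λ (_ : Fin 1) → x} rf single (λ i _ → new i))
    where
    single : Rainbow (λ (_ : Fin 1) → x)
    single {zero} {zero} _ = refl

  new-or-repeated : {f : Fin p → A} {g : Fin q → A} → Rainbow (f ⊕ g) → (x : A) →
                    (∀ j → col (g j) ≢ col x) →
                    p + q + 1 ≤ k ⊎ ∃[ i ] col (f i) ≡ col x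
  new-or-repeated {f = f} {g} rfg x g-new with any? (λ i → col (f i) ≟ col x)
  ... | yes repeated = inj₂ repeated
  ... | no new = inj₁ (rainbow-with-new-colour {f = f ⊕ g} rfg
                  (⊕-all {P = λ v → col v ≢ col x} {f = f} {g = g} (λ i same → new (i , same)) g-new))

module Star {G : Graph} (χ : StarColoring G k) where
  open StarColoring χ
  open Colours col public

  adjacent-distinct : ∀ {u v} → Adj G u v → u ≢ v
  adjacent-distinct {u} uv refl = proper u u uv refl

  no-bicoloured-P4 : ∀ {a b c d} → IsP4 G a b c d → col a ≡ col c → col b ≡ col d → ⊥
  no-bicoloured-P4 {a} {b} {c} {d} path ac bd with star a b c d path
  ... | inj₁ (_ , a≢c , _) = a≢c ac
  ... | inj₂ (inj₁ (_ , _ , b≢d)) = b≢d bd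
  ... | inj₂ (inj₂ (inj₁ (a≢c , _))) = a≢c ac
  ... | inj₂ (inj₂ (inj₂ (_ , b≢d , _))) = b≢d bd

  -- Two distinct vertices of equal colour make any family of common
  -- neighbours rainbow: x - f i - y - f j is a path on four vertices.
  common-neighbours-rainbow : (∀ u v → Adj G u v → Adj G v u) → {x y : V G} {f : Fin p → V G} →
                              x ≢ y → col x ≡ col y → InjectiveFn f →
                              (∀ i → Adj G x (f i)) → (∀ i → Adj G y (f i)) → Rainbow f
  common-neighbours-rainbow adj-sym {x} {y} {f} x≢y same f-inj x∼f y∼f {i} {j} fi∼fj
    with i ≟ j
  ... | yes i≡j = i≡j
  ... | no i≢j = ⊥-elim (no-bicoloured-P4 path same fi∼fj)
    where
    path : IsP4 G x (f i) y (f j)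
    path = ( adjacent-distinct (x∼f i) , x≢y , adjacent-distinct (x∼f j)
           , ≢-sym (adjacent-distinct (y∼f i)) , i≢j ∘ f-inj , adjacent-distinct (y∼f j) )
         , x∼f i , adj-sym y (f i) (y∼f i) , y∼f j

-- In a graph whose edges all cross a bipartition, a colouring that is
-- injective on the true side and uses there no colour of the false side is
-- a star colouring: every P4 has two vertices on the true side.
bipartite-star-colouring : {G : Graph} (side : V G → Bool) →
  (∀ u v → Adj G u v → side u ≢ side v) → (colour : V G → Fin k) →
  (∀ u v → side u ≡ true → side v ≡ true → colour u ≡ colour v → u ≡ v) →
  (∀ u v → side u ≡ true → side v ≡ false → colour u ≢ colour v) →
  StarColoring G k
bipartite-star-colouring {G = G} side crosses colour inj apart =
  record { col = colour ; proper = λ _ _ → proper ; star = star }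
  where
  other-side : ∀ {u v b} → side u ≢ side v → side v ≡ b → side u ≡ not b
  other-side ne sv = trans (¬-not ne) (cong not sv)

  proper : ∀ {u v} → Adj G u v → colour u ≢ colour v
  proper {u} {v} uv with side v in sv
  ... | true = λ e → apart v u sv (other-side (crosses u v uv) sv) (sym e)
  ... | false = apart u v (other-side (crosses u v uv) sv) sv

  -- Along a path w - x - y - z the sides alternate, so either w, y or
  -- x, z lie on the true side.
  star : ∀ w x y z → IsP4 G w x y z →
         AtLeast3 (colour w) (colour x) (colour y) (colour z)
  star w x y z ((_ , w≢y , _ , _ , x≢z , _) , wx , xy , yz) with side x in sx
  ... | false = inj₁ (proper wx , w≢y ∘ inj w y w-true y-true , proper xy)
    where
    w-true : side w ≡ true
    w-true = other-side (crosses w x wx) sx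
    y-true : side y ≡ true
    y-true = other-side (≢-sym (crosses x y xy)) sx
  ... | true = inj₂ (inj₂ (inj₂ (proper xy , x≢z ∘ inj x z sx z-true , proper yz)))
    where
    z-true : side z ≡ true
    z-true = other-side (≢-sym (crosses y z yz)) (other-side (≢-sym (crosses x y xy)) sx)

S-symmetric : {G : Graph} → (∀ u v → Adj G u v → Adj G v u) →
              ∀ u v → Adj (S G) u v → Adj (S G) v u
S-symmetric sym-G (inj₁ u) (inj₁ v) uv = sym-G u v uv
S-symmetric sym-G (inj₁ u) (inj₂ v) uv = sym-G u v uv
S-symmetric sym-G (inj₂ u) (inj₁ v) uv = sym-G u v uv
S-symmetric sym-G (inj₂ _) (inj₂ _) ()

-- A split vertex lies on the same side as the vertex it comes from.
S-bipartite : {G : Graph} (side : V G → Bool) → (∀ u v → Adj G u v → side u ≢ side v) →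
              ∀ u v → Adj (S G) u v → side (reduce u) ≢ side (reduce v)
S-bipartite side crosses (inj₁ u) (inj₁ v) uv = crosses u v uv
S-bipartite side crosses (inj₁ u) (inj₂ v) uv = crosses u v uv
S-bipartite side crosses (inj₂ u) (inj₁ v) uv = crosses u v uv
S-bipartite side crosses (inj₂ _) (inj₂ _) ()

part : Fin m ⊎ Fin n → Bool
part (inj₁ _) = true
part (inj₂ _) = false

K-symmetric : ∀ u v → Adj (K m n) u v → Adj (K m n) v u
K-symmetric (inj₁ _) (inj₂ _) _ = tt
K-symmetric (inj₂ _) (inj₁ _) _ = tt

K-bipartite : ∀ u v → Adj (K m n) u v → part u ≢ part v
K-bipartite (inj₁ _) (inj₂ _) _ ()
K-bipartite (inj₂ _) (inj₁ _) _ ()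

-- All case bounds of the lower-bound argument have the form p + q + 1 ≤ k
-- with p, q ≥ m.
double-bound : m ≤ p → m ≤ q → p + q + 1 ≤ k → 2 * m + 1 ≤ k
double-bound {m} {q = q} m≤p m≤q =
  ≤-trans (+-monoˡ-≤ 1 (+-mono-≤ m≤p (subst (_≤ q) (sym (+-identityʳ m)) m≤q)))

module SplitK (m n : ℕ) where
  G : Graph
  G = S (K m n)

  side : V G → Bool
  side = part ∘ reduce

  crosses : ∀ u v → Adj G u v → side u ≢ side v
  crosses = S-bipartite part K-bipartite

  adj-sym : ∀ u v → Adj G u v → Adj G v u
  adj-sym = S-symmetric K-symmetric

  a a' : Fin m → V G
  a i = inj₁ (inj₁ i)
  a' i = inj₂ (inj₁ i)
  b b' : Fin n → V G
  b j = inj₁ (inj₂ j)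
  b' j = inj₂ (inj₂ j)

  a-adj : ∀ i v → side v ≡ false → Adj G (a i) v
  a-adj i (inj₁ (inj₂ _)) _ = tt
  a-adj i (inj₂ (inj₂ _)) _ = tt
  a-adj i (inj₁ (inj₁ _)) ()
  a-adj i (inj₂ (inj₁ _)) ()

  b-adj : ∀ j u → side u ≡ true → Adj G (b j) u
  b-adj j (inj₁ (inj₁ _)) _ = tt
  b-adj j (inj₂ (inj₁ _)) _ = tt
  b-adj j (inj₁ (inj₂ _)) ()
  b-adj j (inj₂ (inj₂ _)) ()

  layer-colour : Fin 2 → Fin m → Fin (2 * m + 1)
  layer-colour ℓ i = combine ℓ i ↑ˡ 1

  colour : V G → Fin (2 * m + 1)
  colour (inj₁ (inj₁ i)) = layer-colour zero i
  colour (inj₂ (inj₁ i)) = layer-colour (suc zero) i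
  colour (inj₁ (inj₂ _)) = 2 * m ↑ʳ zero
  colour (inj₂ (inj₂ _)) = 2 * m ↑ʳ zero

  layer-colour-injective : ∀ ℓ ℓ' i j → layer-colour ℓ i ≡ layer-colour ℓ' j → ℓ ≡ ℓ' × i ≡ j
  layer-colour-injective ℓ ℓ' i j = combine-injective ℓ i ℓ' j ∘ ↑ˡ-injective 1 _ _

  colour-injective : ∀ u v → side u ≡ true → side v ≡ true → colour u ≡ colour v → u ≡ v
  colour-injective (inj₁ (inj₁ i)) (inj₁ (inj₁ j)) _ _ e
    with refl , refl ← layer-colour-injective zero zero i j e = refl
  colour-injective (inj₁ (inj₁ i)) (inj₂ (inj₁ j)) _ _ e
    with () , _ ← layer-colour-injective zero (suc zero) i j e
  colour-injective (inj₂ (inj₁ i)) (inj₁ (inj₁ j)) _ _ e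
    with () , _ ← layer-colour-injective (suc zero) zero i j e
  colour-injective (inj₂ (inj₁ i)) (inj₂ (inj₁ j)) _ _ e
    with refl , refl ← layer-colour-injective (suc zero) (suc zero) i j e = refl
  colour-injective (inj₁ (inj₂ _)) _ ()
  colour-injective (inj₂ (inj₂ _)) _ ()
  colour-injective (inj₁ (inj₁ _)) (inj₁ (inj₂ _)) _ ()
  colour-injective (inj₁ (inj₁ _)) (inj₂ (inj₂ _)) _ ()
  colour-injective (inj₂ (inj₁ _)) (inj₁ (inj₂ _)) _ ()
  colour-injective (inj₂ (inj₁ _)) (inj₂ (inj₂ _)) _ ()

  colour-apart : ∀ u v → side u ≡ true → side v ≡ false → colour u ≢ colour v
  colour-apart (inj₁ (inj₁ i)) (inj₁ (inj₂ _)) _ _ = ↑ˡ≢↑ʳ _ zero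
  colour-apart (inj₁ (inj₁ i)) (inj₂ (inj₂ _)) _ _ = ↑ˡ≢↑ʳ _ zero
  colour-apart (inj₂ (inj₁ i)) (inj₁ (inj₂ _)) _ _ = ↑ˡ≢↑ʳ _ zero
  colour-apart (inj₂ (inj₁ i)) (inj₂ (inj₂ _)) _ _ = ↑ˡ≢↑ʳ _ zero
  colour-apart (inj₁ (inj₂ _)) _ ()
  colour-apart (inj₂ (inj₂ _)) _ ()
  colour-apart (inj₁ (inj₁ _)) (inj₁ (inj₁ _)) _ ()
  colour-apart (inj₁ (inj₁ _)) (inj₂ (inj₁ _)) _ ()
  colour-apart (inj₂ (inj₁ _)) (inj₁ (inj₁ _)) _ ()
  colour-apart (inj₂ (inj₁ _)) (inj₂ (inj₁ _)) _ ()

  upper-bound : StarColoring G (2 * m + 1)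
  upper-bound = bipartite-star-colouring side crosses colour colour-injective colour-apart

  module LowerBound (χ : StarColoring G k) (a₀ : Fin m) (b₀ : Fin n) where
    open StarColoring χ
    open Star χ

    L : Fin (m + m) → V G
    L = a ⊕ a'
    R : Fin (n + n) → V G
    R = b ⊕ b'

    L-side : ∀ l → side (L l) ≡ true
    L-side = ⊕-all {P = λ v → side v ≡ true} {f = a} {g = a'} (λ _ → refl) (λ _ → refl)

    R-side : ∀ r → side (R r) ≡ false
    R-side = ⊕-all {P = λ v → side v ≡ false} {f = b} {g = b'} (λ _ → refl) (λ _ → refl)

    a-injective : InjectiveFn a
    a-injective refl = refl
    b-injective : InjectiveFn b
    b-injective refl = refl

    L-injective : InjectiveFn L
    L-injective = ⊕-injective {h = id} {f = a} {g = a'} a-injective (λ { refl → refl }) (λ _ _ ())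

    R-injective : InjectiveFn R
    R-injective = ⊕-injective {h = id} {f = b} {g = b'} b-injective (λ { refl → refl }) (λ _ _ ())

    -- If A ∪ A' is rainbow, the original b₀ adds a new colour.
    L-rainbow-bound : Rainbow L → m + m + 1 ≤ k
    L-rainbow-bound rL =
      rainbow-with-new-colour rL (λ l → proper (b b₀) (L l) (b-adj b₀ (L l) (L-side l)) ∘ sym)

    L-collision⇒b-rainbow : Collision L → Rainbow b
    L-collision⇒b-rainbow (l , l' , l≢l' , same) =
      common-neighbours-rainbow adj-sym (l≢l' ∘ L-injective) same b-injective
        (λ j → adj-sym (b j) (L l) (b-adj j (L l) (L-side l)))
        (λ j → adj-sym (b j) (L l') (b-adj j (L l') (L-side l')))

    -- Two equally coloured vertices of A make B ∪ B' rainbow, and the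
    -- original a₀ adds a new colour.
    a-collision-bound : Collision a → n + n + 1 ≤ k
    a-collision-bound (i , i' , i≢i' , same) =
      rainbow-with-new-colour R-rainbow (λ r → proper (a a₀) (R r) (a-adj a₀ (R r) (R-side r)) ∘ sym)
      where
      R-rainbow : Rainbow R
      R-rainbow = common-neighbours-rainbow adj-sym (i≢i' ∘ a-injective) same R-injective
                    (λ r → a-adj i (R r) (R-side r)) (λ r → a-adj i' (R r) (R-side r))

    -- If A and B are rainbow, then A ∪ B is rainbow (A and B are joined)
    -- and a'₀ or b'₀ brings a new colour: if a'₀ repeats the colour of aᵢ
    -- and b'₀ that of bⱼ, the path a'₀ - bⱼ - aᵢ - b'₀ is 2-coloured.
    sides-rainbow-bound : Rainbow a → Rainbow b → m + n + 1 ≤ k ⊎ n + m + 1 ≤ k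
    sides-rainbow-bound rA rB
      with new-or-repeated rAB (a' a₀) (λ j → proper (b j) (a' a₀) tt)
         | new-or-repeated rBA (b' b₀) (λ i → proper (a i) (b' b₀) tt)
      where
      rAB : Rainbow (a ⊕ b)
      rAB = rainbow-⊕ rA rB (λ i j → proper (a i) (b j) tt)
      rBA : Rainbow (b ⊕ a)
      rBA = rainbow-⊕ rB rA (λ j i → proper (b j) (a i) tt)
    ... | inj₁ bound | _ = inj₁ bound
    ... | inj₂ _ | inj₁ bound = inj₂ bound
    ... | inj₂ (i , aᵢ≈a'₀) | inj₂ (j , bⱼ≈b'₀) = ⊥-elim (no-bicoloured-P4 path (sym aᵢ≈a'₀) bⱼ≈b'₀)
      where
      path : IsP4 G (a' a₀) (b j) (a i) (b' b₀)
      path = ((λ ()) , (λ ()) , (λ ()) , (λ ()) , (λ ()) , (λ ())) , tt , tt , tt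

    lower-bound : m ≤ n → 2 * m + 1 ≤ k
    lower-bound m≤n with rainbow-or-collision L
    ... | inj₁ rL = double-bound {m = m} ≤-refl ≤-refl (L-rainbow-bound rL)
    ... | inj₂ cL with rainbow-or-collision a
    ...   | inj₂ cA = double-bound {m = m} m≤n m≤n (a-collision-bound cA)
    ...   | inj₁ rA with sides-rainbow-bound rA (L-collision⇒b-rainbow cL)
    ...     | inj₁ bound = double-bound {m = m} ≤-refl m≤n bound
    ...     | inj₂ bound = double-bound {m = m} m≤n ≤-refl bound

theorem4 : ∀ (m n : ℕ) → 1 ≤ m → m ≤ n →
    StarChromaticNumber (S (K m n)) (2 * m + 1)
theorem4 m n 1≤m m≤n = upper-bound , no-smaller
  where
  open SplitK m n
  a₀ : Fin m
  a₀ = fromℕ< 1≤m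
  b₀ : Fin n
  b₀ = fromℕ< (≤-trans 1≤m m≤n)

  no-smaller : ∀ j → j < 2 * m + 1 → StarColoring (S (K m n)) j → ⊥
  no-smaller j j<2m+1 χ = <⇒≱ j<2m+1 (LowerBound.lower-bound χ a₀ b₀ m≤n)
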